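{- In the setting of the context, with $c_0=c_\emptyset$, one has ${}^{c_0}_{\delta,\gamma}\mathcal P^{c_\infty}_\epsilon=\tilde{\mathcal P}^{c_\infty}_\rho$.
   Context: $\overline{[n]}=\{1<\dots<n<\overline n<\dots<\overline1\}$, $\overline{\overline k}=k$, $\chi$ = truth value in $\{0,1\}$. $\mathcal B=\{\emptyset\}\sqcup\{(x,y):x\le y\in\overline{[n]}\}$ with $H(\emptyset\otimes\emptyset)=0$, $H(\emptyset\otimes(x,y))=H((x,y)\otimes\emptyset)=1$, $H((x,y)\otimes(x',y'))=\chi(x\ge x')+\chi(y\ge y')-\chi(y\ge y'>x\ge x')$ if $\overline{y'}\ne x$, $=\chi(x>x')+\chi(y>y')-\chi(y>y'>x>x')$ if $\overline{y'}=x$. Colours $\mathcal C=\{c_b:b\in\mathcal B\}$, $c_{x,y}:=c_{(x,y)}$; $\mathcal C_{\mathrm{free}}=\{c_\emptyset\}\cup\{c_{x,\overline x}:1\le x\le n\}$, $\mathcal C_{\mathrm{sup}}=\{c_{x,y}:\overline y<x\le y\}$, $\mathcal C_{\mathrm{inf}}=\{c_{x,y}:x\le y<\overline x\}$; $c_\infty\notin\mathcal C$; $\mathcal S=\mathcal C\setminus\{c_\emptyset\}$. $\epsilon(c_{b'},c_b)=H(b\otimes b')$ for $b,b'\in\mathcal B$, and $\epsilon(\cdot,c_\infty)$ takes any values with $\epsilon(f,c_\infty)=1$ ($f\in\mathcal C_{\mathrm{free}}$), $\epsilon(c,c_\infty)\in\{1,2\}$ ($c\in\mathcal C_{\mathrm{inf}}$),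 $\epsilon(c,c_\infty)\in\{0,1\}$ ($c\in\mathcal C_{\mathrm{sup}}$). $\delta(c_{x,y})=c_{\overline y,y}$ on $\mathcal C_{\mathrm{sup}}$ and $c_{x,\overline x}$ on $\mathcal C_{\mathrm{inf}}$; $\gamma(c_{x,y},c_{x',y'})=c_{z,\overline z}$, $z=\max\{x',\overline y\}$, for $(c_{x,y},c_{x',y'})\in\mathcal C_{\mathrm{sup}}\times\mathcal C_{\mathrm{inf}}$ with $\epsilon=0$; $=c_{\overline y,y}$ on pairs in $\mathcal C_{\mathrm{sup}}^2$ with $\epsilon\in\{0,1\}$; $=c_{x',\overline{x'}}$ on pairs in $\mathcal C_{\mathrm{inf}}^2$ with $\epsilon\in\{0,1\}$. Coloured integers $k_c$ ($k\in\mathbb Z$); $k_c\gg_\epsilon k'_{c'}$ iff $k-k'\ge\epsilon(c,c')$. $\mathcal P^{c_\infty}_\epsilon$: sequences $(\pi_0,\dots,\pi_{s-1},0_{c_\infty})$, $c(\pi_j)\in\mathcal C$, consecutive parts related by $\gg_\epsilon$. A sequence contains a pattern if the pattern occurs as consecutive parts. ${}^{c_0}_{\delta,\gamma}\mathcal P^{c_\infty}_\epsilon$: elements of $\mathcal P^{c_\infty}_\epsilon$ with no part of colour $c_0$ avoiding, for all integers $p\ge0$: (1) $p_c,p_c$, $c\in\mathcal C_{\mathrm{free}}\setminus\{c_0\}$; (2) $p_c,p_{\gamma(c,c')},p_{c'}$, $(c,c')\in\mathcal C_{\mathrm{sup}}\times\mathcal C_{\mathrm{inf}}$, $\epsilon(c,c')=0$;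 (3) $p_c,p_{\gamma(c,c')},(p-1)_{c'}$, $c,c'\in\mathcal C_{\mathrm{sup}}$, $\epsilon(c,c')\in\{0,1\}$; (4) $(p+1)_c,p_{\gamma(c,c')},p_{c'}$, $c,c'\in\mathcal C_{\mathrm{inf}}$, $\epsilon(c,c')\in\{0,1\}$; (5) for $c\in\mathcal C_{\mathrm{sup}}$: $p_c,p_{\delta(c)},(p-1)_{c'}$ with $c'\in(\mathcal C_{\mathrm{free}}\setminus\{c_0\})\sqcup\mathcal C_{\mathrm{inf}}\sqcup\{c_\infty\}$, and $p_c,p_{\delta(c)},(p-u)_{c'}$ with $c'\in(\mathcal C\setminus\{c_0\})\sqcup\{c_\infty\}$, $u\ge2$; (6) for $c'\in\mathcal C_{\mathrm{inf}}$: $p_{\delta(c')},p_{c'}$ as the first two parts, $(p+1)_c,p_{\delta(c')},p_{c'}$ with $c\in(\mathcal C_{\mathrm{free}}\setminus\{c_0\})\sqcup\mathcal C_{\mathrm{sup}}$, and $(p+u)_c,p_{\delta(c')},p_{c'}$ with $c\in\mathcal C\setminus\{c_0\}$, $u\ge2$. $\rho$ on $\mathcal S\times(\mathcal S\sqcup\{c_\infty\})$: $\rho(c,c_\infty)=\epsilon(c,c_\infty)$, $\rho(c_{x',y'},c_{x,y})=\chi(x\ge x')+\chi(y\ge y')-\chi(y\ge y'>x\ge x')$. $\tilde{\mathcal P}^{c_\infty}_\rho$: sequences $(\pi_0,\dots,\pi_{s-1},0_{c_\infty})$ with $c(\pi_j)\in\mathcal S$ and $|\pi_j|-|\pi_{j+1}|\ge\rho(c(\pi_j),c(\pi_{j+1}))$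 for $j<s$. -}

module Defs where

open import Data.Nat as ℕ using (ℕ; suc; _+_)
open import Data.Integer as ℤ using (ℤ; +_; _-_)
open import Data.Fin as F using (Fin; toℕ; opposite)
open import Data.Fin.Properties using (_≤?_; _<?_; _≟_)
open import Data.Bool using (Bool; true; false; _∧_; if_then_else_)
open import Data.Product using (Σ; ∃; _×_; _,_)
open import Data.Sum using (_⊎_)
open import Data.Empty using (⊥)
open import Data.Unit using (⊤)
open import Data.List using (List; []; _∷_)
open import Data.List.Relation.Unary.All using (All)
open import Relation.Nullary using (¬_)
open import Relation.Nullary.Decidable using (⌊_⌋)
open import Relation.Binary.PropositionalEquality using (_≡_; _≢_)

-- The ordered alphabet  1 < ... < n < n̄ < ... < 1̄  is  Fin (n + n):
-- k ↦ k-1 and k̄ ↦ 2n-k, so the order is the order of Fin and the bar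
-- involution is  opposite  (i ↦ 2n-1-i).

Letter : ℕ → Set
Letter n = Fin (n + n)


-- Raw colours: c_∅ and c_{x,y}.  A raw colour lies in 𝒞 iff it is valid
-- (x ≤ y), see InC.
data Col (n : ℕ) : Set where
  c∅ : Col n
  cp : Letter n → Letter n → Col n

data XCol (n : ℕ) : Set where
  col : Col n → XCol n
  c∞  : XCol n

Part : ℕ → Set
Part n = ℤ × Col n

XPart : ℕ → Set
XPart n = ℤ × XCol n

module _ {n : ℕ} where

  bar : Letter n → Letter n
  bar = opposite

  InC : Col n → Set
  InC c∅       = ⊤
  InC (cp x y) = x F.≤ y

  InS : Col n → Set
  InS c = InC c × c ≢ c∅

  Free : Col n → Set
  Free c∅           = ⊤
  Free (cp x y) = (y ≡ bar x) × (toℕ x ℕ.< n)   -- x ∈ {1,…,n}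

  Sup : Col n → Set
  Sup c∅       = ⊥
  Sup (cp x y) = (bar y F.< x) × (x F.≤ y)

  Inf : Col n → Set
  Inf c∅       = ⊥
  Inf (cp x y) = (x F.≤ y) × (y F.< bar x)

  Free₀ : Col n → Set
  Free₀ c = Free c × c ≢ c∅

  χ : Bool → ℤ
  χ true  = + 1
  χ false = + 0

  _≥ᵇ_ _>ᵇ_ : Letter n → Letter n → Bool
  a ≥ᵇ b = ⌊ b ≤? a ⌋
  a >ᵇ b = ⌊ b <? a ⌋

  H : Col n → Col n → ℤ
  H c∅ c∅ = + 0
  H c∅ (cp _ _) = + 1
  H (cp _ _) c∅ = + 1
  H (cp x y) (cp x' y') =
    if ⌊ bar y' ≟ x ⌋
    then (χ (x >ᵇ x') ℤ.+ χ (y >ᵇ y')) - χ ((y >ᵇ y') ∧ (y' >ᵇ x) ∧ (x >ᵇ x'))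
    else (χ (x ≥ᵇ x') ℤ.+ χ (y ≥ᵇ y')) - χ ((y ≥ᵇ y') ∧ (y' >ᵇ x) ∧ (x ≥ᵇ x'))

  ε : Col n → Col n → ℤ
  ε c' c = H c c'

  -- admissible values of ε(·, c_∞)
  Admissible : (Col n → ℤ) → Set
  Admissible E =
      (∀ (c : Col n) → Free c → E c ≡ + 1)
    × (∀ (c : Col n) → Inf c → E c ≡ + 1 ⊎ E c ≡ + 2)
    × (∀ (c : Col n) → Sup c → E c ≡ + 0 ⊎ E c ≡ + 1)

  εX : (Col n → ℤ) → Col n → XCol n → ℤ
  εX E c (col c') = ε c c'
  εX E c c∞       = E c

  -- ρ(c_{x',y'}, c_{x,y}), and ρ(c, c_∞) = ε(c, c_∞)
  -- (the value at c_∅ is irrelevant: ρ is only used on 𝒮)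
  ρ₀ : Col n → Col n → ℤ
  ρ₀ (cp x' y') (cp x y) =
    (χ (x ≥ᵇ x') ℤ.+ χ (y ≥ᵇ y')) - χ ((y ≥ᵇ y') ∧ (y' >ᵇ x) ∧ (x ≥ᵇ x'))
  ρ₀ _ _ = + 0

  ρ : (Col n → ℤ) → Col n → XCol n → ℤ
  ρ E c (col c') = ρ₀ c c'
  ρ E c c∞       = E c

  δsup : Col n → Col n
  δsup (cp x y) = cp (bar y) y
  δsup c∅       = c∅

  δinf : Col n → Col n
  δinf (cp x y) = cp x (bar x)
  δinf c∅       = c∅

  maxL : Letter n → Letter n → Letter n
  maxL a b = if ⌊ a ≤? b ⌋ then b else a

  γsi : Col n → Col n → Col n
  γsi (cp x y) (cp x' y') = cp (maxL x' (bar y)) (bar (maxL x' (bar y)))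
  γsi _ _ = c∅

  γss : Col n → Col n → Col n
  γss (cp x y) _ = cp (bar y) y
  γss c∅ _ = c∅

  γii : Col n → Col n → Col n
  γii _ (cp x' y') = cp x' (bar x')
  γii _ c∅ = c∅

  -- Sequences.  A list ps = (π_0,…,π_{s-1}) of coloured integers stands
  -- for the sequence (π_0,…,π_{s-1},0_{c_∞}).


  inj : Part n → XPart n
  inj (k , c) = (k , col c)

  full : List (Part n) → List (XPart n)
  full []       = (+ 0 , c∞) ∷ []
  full (p ∷ ps) = inj p ∷ full ps

  Chain : (Part n → XPart n → Set) → List (Part n) → Set
  Chain R []                = ⊤
  Chain R (p ∷ [])          = R p (+ 0 , c∞)
  Chain R (p ∷ (q ∷ qs))    = R p (inj q) × Chain R (q ∷ qs)

  -- k_c ≫_ε k'_{c'}  iff  k - k' ≥ ε(c,c')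
  Gg : (Col n → ℤ) → Part n → XPart n → Set
  Gg E (k , c) (k' , c') = εX E c c' ℤ.≤ k - k'

  InP : (Col n → ℤ) → List (Part n) → Set
  InP E ps = All (λ π → InC (Data.Product.proj₂ π)) ps × Chain (Gg E) ps

  Occ2 : (XPart n → XPart n → Set) → List (XPart n) → Set
  Occ2 P (a ∷ b ∷ r) = P a b ⊎ Occ2 P (b ∷ r)
  Occ2 P _ = ⊥

  Occ3 : (XPart n → XPart n → XPart n → Set) → List (XPart n) → Set
  Occ3 P (a ∷ b ∷ d ∷ r) = P a b d ⊎ Occ3 P (b ∷ d ∷ r)
  Occ3 P _ = ⊥

  First2 : (XPart n → XPart n → Set) → List (XPart n) → Set
  First2 P (a ∷ b ∷ r) = P a b
  First2 P _ = ⊥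

  Cls5a : XCol n → Set
  Cls5a (col c) = Free₀ c ⊎ Inf c
  Cls5a c∞      = ⊤

  Cls5b : XCol n → Set
  Cls5b (col c) = InS c
  Cls5b c∞      = ⊤

  -- forbidden pattern (1)
  Bad2 : XPart n → XPart n → Set
  Bad2 a b = Σ ℕ λ p → Σ (Col n) λ c →
    Free₀ c × a ≡ (+ p , col c) × b ≡ (+ p , col c)

  -- forbidden pattern (6), first clause: p_{δ(c')}, p_{c'} as first two parts
  BadStart : XPart n → XPart n → Set
  BadStart a b = Σ ℕ λ p → Σ (Col n) λ c' →
    Inf c' × a ≡ (+ p , col (δinf c')) × b ≡ (+ p , col c')

  Bad3 : XPart n → XPart n → XPart n → Set
  Bad3 a b d = Σ ℕ λ p →
      -- (2)
      (Σ (Col n) λ c → Σ (Col n) λ c' → Sup c × Inf c' × ε c c' ≡ + 0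
         × a ≡ (+ p , col c) × b ≡ (+ p , col (γsi c c')) × d ≡ (+ p , col c'))
    ⊎ -- (3)
      (Σ (Col n) λ c → Σ (Col n) λ c' → Sup c × Sup c' × (ε c c' ≡ + 0 ⊎ ε c c' ≡ + 1)
         × a ≡ (+ p , col c) × b ≡ (+ p , col (γss c c')) × d ≡ (+ p - + 1 , col c'))
    ⊎ -- (4)
      (Σ (Col n) λ c → Σ (Col n) λ c' → Inf c × Inf c' × (ε c c' ≡ + 0 ⊎ ε c c' ≡ + 1)
         × a ≡ (+ suc p , col c) × b ≡ (+ p , col (γii c c')) × d ≡ (+ p , col c'))
    ⊎ -- (5), first clause
      (Σ (Col n) λ c → Σ (XCol n) λ c' → Sup c × Cls5a c'
         × a ≡ (+ p , col c) × b ≡ (+ p , col (δsup c)) × d ≡ (+ p - + 1 , c'))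
    ⊎ -- (5), second clause
      (Σ (Col n) λ c → Σ (XCol n) λ c' → Σ ℕ λ u → Sup c × Cls5b c' × 2 ℕ.≤ u
         × a ≡ (+ p , col c) × b ≡ (+ p , col (δsup c)) × d ≡ (+ p - + u , c'))
    ⊎ -- (6), second clause
      (Σ (Col n) λ c → Σ (Col n) λ c' → Inf c' × (Free₀ c ⊎ Sup c)
         × a ≡ (+ suc p , col c) × b ≡ (+ p , col (δinf c')) × d ≡ (+ p , col c'))
    ⊎ -- (6), third clause
      (Σ (Col n) λ c → Σ (Col n) λ c' → Σ ℕ λ u → Inf c' × InS c × 2 ℕ.≤ u
         × a ≡ (+ (p + u) , col c) × b ≡ (+ p , col (δinf c')) × d ≡ (+ p , col c'))

  InPδγ : (Col n → ℤ) → List (Part n) → Set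
  InPδγ E ps =
      InP E ps
    × All (λ π → Data.Product.proj₂ π ≢ c∅) ps
    × ¬ Occ2 Bad2 (full ps)
    × ¬ Occ3 Bad3 (full ps)
    × ¬ First2 BadStart (full ps)

  InPρ : (Col n → ℤ) → List (Part n) → Set
  InPρ E ps =
      All (λ π → InS (Data.Product.proj₂ π)) ps
    × Chain (λ { (k , c) (k' , c') → ρ E c c' ℤ.≤ k - k' }) ps

{-# OPTIONS --safe #-}
module Submission where

-- Always ε ≤ ρ, and
-- ε ≠ ρ only at three kinds of defective steps, where ε = 0 and ρ = 1: a repeated
-- free colour, (δ(c'), c') with c' ∈ 𝒞_inf, and (c, δ(c)) with c ∈ 𝒞_sup.  So a
-- ρ-sequence is an ε-sequence, and it avoids the patterns since each of them has a
-- step of ρ-weight ≥ 1 between equal parts.  Conversely, in a pattern-avoiding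
-- ε-sequence no defective step joins equal parts: a repeated free colour is
-- pattern (1); a step (δ(c'), c') is pattern (6) at the start, and otherwise the
-- drop from the preceding part completes (1), (2), (4) or (6); for a step
-- (c, δ(c)) the drop to the following part completes (1), (2), (3) or (5).

open import Defs
open import Data.Nat as ℕ using (ℕ; zero; suc; z≤n; s≤s)
import Data.Nat.Properties as ℕₚ
open import Data.Integer as ℤ using (ℤ; +_; +≤+; _⊖_)
import Data.Integer.Properties as ℤₚ
open import Data.Fin as F using (toℕ)
import Data.Fin.Properties as Fₚ
open import Data.Bool using (Bool; true; false; _∧_; if_then_else_)
open import Data.Bool.Properties using (if-eta)
open import Data.Product using (_×_; _,_; proj₁; proj₂)
open import Data.Sum using (_⊎_; inj₁; inj₂; [_,_]′)
open import Data.Empty using (⊥; ⊥-elim)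
open import Data.Unit using (tt)
open import Data.List using (List; []; _∷_)
open import Data.List.Relation.Unary.All using (All; []; _∷_; zip; unzip)
open import Function.Base using (_∘_)
open import Function.Bundles using (_⇔_; mk⇔)
open import Relation.Nullary using (Dec; yes; no; ¬_)
open import Relation.Nullary.Decidable using (isYes)
open import Relation.Binary.PropositionalEquality
open import Relation.Binary.Definitions using (tri<; tri≈; tri>)

1+m+m≢n+n : ∀ m k → suc (m ℕ.+ m) ≢ k ℕ.+ k
1+m+m≢n+n m k e = ℕₚ.even≢odd k m
  (subst₂ (λ a b → k ℕ.+ a ≡ suc (m ℕ.+ b))
          (sym (ℕₚ.+-identityʳ k)) (sym (ℕₚ.+-identityʳ m)) (sym e))

+[m+n]-+n≡+m : ∀ m u → + (m ℕ.+ u) ℤ.- + u ≡ + m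
+[m+n]-+n≡+m m u = begin
  + (m ℕ.+ u) ℤ.- + u  ≡⟨ ℤₚ.[+m]-[+n]≡m⊖n (m ℕ.+ u) u ⟩
  (m ℕ.+ u) ⊖ u        ≡⟨ ℤₚ.⊖-≥ (ℕₚ.m≤n+m u m) ⟩
  + (m ℕ.+ u ℕ.∸ u)    ≡⟨ cong +_ (ℕₚ.m+n∸n≡m m u) ⟩
  + m                  ∎
  where open ≡-Reasoning

1≤i-j : ∀ {i j} → + 0 ℤ.≤ i ℤ.- j → i ≢ j → + 1 ℤ.≤ i ℤ.- j
1≤i-j {i} {j} 0≤i-j i≢j = positive 0≤i-j (i≢j ∘ ℤₚ.i-j≡0⇒i≡j i j)
  where
  positive : ∀ {k} → + 0 ℤ.≤ k → k ≢ + 0 → + 1 ℤ.≤ k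
  positive {+ zero}  _ k≢0 = ⊥-elim (k≢0 refl)
  positive {+ suc _} _ _   = +≤+ (s≤s z≤n)

≥1⇒≰i-i : ∀ {r} i → + 1 ℤ.≤ r → ¬ (r ℤ.≤ i ℤ.- i)
≥1⇒≰i-i i 1≤r r≤0 with ℤₚ.≤-trans 1≤r (subst (_ ℤ.≤_) (ℤₚ.+-inverseʳ i) r≤0)
... | +≤+ ()

nonneg-≡ : ∀ {k m} → k ≡ + m → + 0 ℤ.≤ k
nonneg-≡ refl = +≤+ z≤n

nonneg-above : ∀ {e k k'} → + 0 ℤ.≤ e → e ℤ.≤ k ℤ.- k' → + 0 ℤ.≤ k' → + 0 ℤ.≤ k
nonneg-above {k = k} {k' = k'} 0≤e e≤k-k' (+≤+ _) =
  ℤₚ.≤-trans 0≤e (ℤₚ.≤-trans e≤k-k' (ℤₚ.i-j≤i k k'))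

-- The drops k - k' ≥ e ≥ 0 between consecutive parts, split into the three
-- shapes in which sizes occur in the forbidden patterns.
data Gap (e : ℤ) : ℤ → ℤ → Set where
  flat  : ∀ q → e ℤ.≤ + 0 → Gap e (+ q) (+ q)
  unit  : ∀ q → e ℤ.≤ + 1 → Gap e (+ suc q) (+ q)
  large : ∀ q u → 2 ℕ.≤ u → Gap e (+ (q ℕ.+ u)) (+ q)

Gap-suc : ∀ {e p q} → Gap e (+ p) (+ q) → Gap e (+ suc p) (+ suc q)
Gap-suc (flat q e≤0)    = flat (suc q) e≤0
Gap-suc (unit q e≤1)    = unit (suc q) e≤1
Gap-suc (large q u 2≤u) = large (suc q) u 2≤u

gap : ∀ {e k k'} → + 0 ℤ.≤ k' → + 0 ℤ.≤ e → e ℤ.≤ k ℤ.- k' → Gap e k k'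
gap {e} {k} {k'} 0≤k' 0≤e e≤k-k' with nonneg-above {k = k} 0≤e e≤k-k' 0≤k' | 0≤k'
... | +≤+ {n = m} _ | +≤+ {n = m′} _ =
  gap⊖ m m′ (subst (e ℤ.≤_) (ℤₚ.[+m]-[+n]≡m⊖n m m′) e≤k-k')
  where
  gap⊖ : ∀ p q → e ℤ.≤ p ⊖ q → Gap e (+ p) (+ q)
  gap⊖ zero          zero    e≤0 = flat 0 e≤0
  gap⊖ zero          (suc q) e≤  with ℤₚ.≤-trans 0≤e e≤
  ... | ()
  gap⊖ (suc zero)    zero    e≤1 = unit 0 e≤1
  gap⊖ (suc (suc p)) zero    _   = large 0 (suc (suc p)) (s≤s (s≤s z≤n))
  gap⊖ (suc p)       (suc q) e≤  =
    Gap-suc (gap⊖ p q (subst (e ℤ.≤_) (ℤₚ.[1+m]⊖[1+n]≡m⊖n p q) e≤))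

isYes-true : ∀ {a} {A : Set a} (d : Dec A) → A → isYes d ≡ true
isYes-true (yes _) _  = refl
isYes-true (no ¬a) a  = ⊥-elim (¬a a)

isYes-false : ∀ {a} {A : Set a} (d : Dec A) → ¬ A → isYes d ≡ false
isYes-false (yes a) ¬a = ⊥-elim (¬a a)
isYes-false (no _)  _  = refl

isYes-true⁻¹ : ∀ {a} {A : Set a} (d : Dec A) → isYes d ≡ true → A
isYes-true⁻¹ (yes a) _ = a
isYes-true⁻¹ (no _)  ()

isYes-false⁻¹ : ∀ {a} {A : Set a} (d : Dec A) → isYes d ≡ false → ¬ A
isYes-false⁻¹ (yes _) ()
isYes-false⁻¹ (no ¬a) _ = ¬a

module _ {n : ℕ} where

  -- Specialisations at n, which cannot be inferred from Letter n = Fin (n + n).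
  infix 25 ‾_
  ‾_ : Letter n → Letter n
  ‾_ = bar {n}

  _≥b_ _>b_ : Letter n → Letter n → Bool
  _≥b_ = _≥ᵇ_ {n}
  _>b_ = _>ᵇ_ {n}

  maxL′ : Letter n → Letter n → Letter n
  maxL′ = maxL {n}

  toℕ-‾ : ∀ x → toℕ (‾ x) ℕ.+ suc (toℕ x) ≡ n ℕ.+ n
  toℕ-‾ x = trans (cong (ℕ._+ suc (toℕ x)) (Fₚ.opposite-prop x)) (ℕₚ.m∸n+n≡m (Fₚ.toℕ<n x))

  ‾-involutive : ∀ x → ‾ (‾ x) ≡ x
  ‾-involutive = Fₚ.opposite-involutive

  ‾-reverses-< : ∀ {x y} → x F.< y → ‾ y F.< ‾ x
  ‾-reverses-< {x} {y} x<y =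
    subst₂ ℕ._<_ (sym (Fₚ.opposite-prop y)) (sym (Fₚ.opposite-prop x))
           (ℕₚ.∸-monoʳ-< (s≤s x<y) (Fₚ.toℕ<n y))

  ‾<-sym : ∀ {x y} → ‾ y F.< x → ‾ x F.< y
  ‾<-sym {x} {y} ‾y<x = subst (‾ x F.<_) (‾-involutive y) (‾-reverses-< ‾y<x)

  <‾-sym : ∀ {x y} → x F.< ‾ y → y F.< ‾ x
  <‾-sym {x} {y} x<‾y = subst (F._< ‾ x) (‾-involutive y) (‾-reverses-< x<‾y)

  ‾x≢x : ∀ x → ‾ x ≢ x
  ‾x≢x x ‾x≡x = 1+m+m≢n+n (toℕ x) n
    (trans (sym (ℕₚ.+-suc (toℕ x) (toℕ x)))
           (subst (λ z → toℕ z ℕ.+ suc (toℕ x) ≡ n ℕ.+ n) ‾x≡x (toℕ-‾ x)))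

  x<‾x⇒toℕ<n : ∀ {x} → x F.< ‾ x → toℕ x ℕ.< n
  x<‾x⇒toℕ<n {x} x<‾x with toℕ x ℕₚ.<? n
  ... | yes x<n = x<n
  ... | no x≮n = ⊥-elim (ℕₚ.<-irrefl refl (subst (n ℕ.+ n ℕ.<_) (toℕ-‾ x)
         (ℕₚ.≤-<-trans (ℕₚ.+-mono-≤ (ℕₚ.≮⇒≥ x≮n) (ℕₚ.≮⇒≥ x≮n))
                       (ℕₚ.+-mono-< x<‾x (ℕₚ.n<1+n (toℕ x))))))

  toℕ<n⇒x<‾x : ∀ {x} → toℕ x ℕ.< n → x F.< ‾ x
  toℕ<n⇒x<‾x {x} x<n with toℕ x ℕₚ.<? toℕ (‾ x)
  ... | yes x<‾x = x<‾x
  ... | no x≮‾x = ⊥-elim (ℕₚ.<-irrefl refl (subst (ℕ._< n ℕ.+ n) (toℕ-‾ x)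
         (ℕₚ.≤-<-trans (ℕₚ.+-monoˡ-≤ (suc (toℕ x)) (ℕₚ.≮⇒≥ x≮‾x)) (ℕₚ.+-mono-<-≤ x<n x<n))))

  ≥b-true : ∀ x x' → x' F.≤ x → x ≥b x' ≡ true
  ≥b-true x x' = isYes-true (x' Fₚ.≤? x)

  ≥b-false : ∀ x x' → x F.< x' → x ≥b x' ≡ false
  ≥b-false x x' x<x' = isYes-false (x' Fₚ.≤? x) (ℕₚ.<⇒≱ x<x')

  >b-true : ∀ x x' → x' F.< x → x >b x' ≡ true
  >b-true x x' = isYes-true (x' Fₚ.<? x)

  >b-false : ∀ x x' → x F.≤ x' → x >b x' ≡ false
  >b-false x x' x≤x' = isYes-false (x' Fₚ.<? x) (ℕₚ.≤⇒≯ x≤x')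

  ≥b-true⁻¹ : ∀ x x' → x ≥b x' ≡ true → x' F.≤ x
  ≥b-true⁻¹ x x' = isYes-true⁻¹ (x' Fₚ.≤? x)

  ≥b-false⁻¹ : ∀ x x' → x ≥b x' ≡ false → x F.< x'
  ≥b-false⁻¹ x x' e = ℕₚ.≰⇒> (isYes-false⁻¹ (x' Fₚ.≤? x) e)

  >b-false⁻¹ : ∀ x x' → x >b x' ≡ false → x F.≤ x'
  >b-false⁻¹ x x' e = ℕₚ.≮⇒≥ (isYes-false⁻¹ (x' Fₚ.<? x) e)

  ≥b≡>b : ∀ x x' → x ≢ x' → x ≥b x' ≡ x >b x'
  ≥b≡>b x x' x≢x' with Fₚ.<-cmp x' x
  ... | tri< x'<x _ _ = trans (≥b-true x x' (ℕₚ.<⇒≤ x'<x)) (sym (>b-true x x' x'<x))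
  ... | tri≈ _ x'≡x _ = ⊥-elim (x≢x' (sym x'≡x))
  ... | tri> _ _ x<x' = trans (≥b-false x x' x<x') (sym (>b-false x x' (ℕₚ.<⇒≤ x<x')))

  maxL-≤ : ∀ {a b} → a F.≤ b → maxL′ a b ≡ b
  maxL-≤ {a} {b} a≤b = cong (if_then b else a) (isYes-true (a Fₚ.≤? b) a≤b)

  maxL-> : ∀ {a b} → b F.< a → maxL′ a b ≡ a
  maxL-> {a} {b} b<a = cong (if_then b else a) (isYes-false (a Fₚ.≤? b) (ℕₚ.<⇒≱ b<a))

  maxL-idem : ∀ a → maxL′ a a ≡ a
  maxL-idem a = if-eta (isYes (a Fₚ.≤? a))

  -- ρ₀ (cp x' y') (cp x y) unfolds to energy (x ≥b x') (y ≥b y') (y' >b x), and so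
  -- does ε (cp x' y') (cp x y) when ȳ' ≢ x; when ȳ' = x, ε has x >b x' and y >b y'.
  energy : Bool → Bool → Bool → ℤ
  energy A B C = (χ {n} A ℤ.+ χ {n} B) ℤ.- χ {n} (B ∧ C ∧ A)

  energy-cong : ∀ {A B C a b c} → A ≡ a → B ≡ b → C ≡ c → energy A B C ≡ energy a b c
  energy-cong refl refl refl = refl

  energy-nonneg : ∀ A B C → + 0 ℤ.≤ energy A B C
  energy-nonneg false false _     = +≤+ z≤n
  energy-nonneg false true  false = +≤+ z≤n
  energy-nonneg false true  true  = +≤+ z≤n
  energy-nonneg true  false _     = +≤+ z≤n
  energy-nonneg true  true  false = +≤+ z≤n
  energy-nonneg true  true  true  = +≤+ z≤n

  energy≤0⇒ : ∀ A B C → energy A B C ℤ.≤ + 0 → A ≡ false × B ≡ false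
  energy≤0⇒ false false _     _           = refl , refl
  energy≤0⇒ false true  false (+≤+ ())
  energy≤0⇒ false true  true  (+≤+ ())
  energy≤0⇒ true  false _     (+≤+ ())
  energy≤0⇒ true  true  false (+≤+ ())
  energy≤0⇒ true  true  true  (+≤+ ())

  energy-A≥1 : ∀ {A} B C → A ≡ true → + 1 ℤ.≤ energy A B C
  energy-A≥1 false _     refl = +≤+ (s≤s z≤n)
  energy-A≥1 true  false refl = +≤+ (s≤s z≤n)
  energy-A≥1 true  true  refl = +≤+ (s≤s z≤n)

  energy-B≥1 : ∀ A {B} C → B ≡ true → + 1 ℤ.≤ energy A B C
  energy-B≥1 false false refl = +≤+ (s≤s z≤n)
  energy-B≥1 false true  refl = +≤+ (s≤s z≤n)
  energy-B≥1 true  C     refl = energy-A≥1 true C refl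

  energy-¬A≤1 : ∀ {A} B C → A ≡ false → energy A B C ℤ.≤ + 1
  energy-¬A≤1 false _     refl = +≤+ z≤n
  energy-¬A≤1 true  false refl = +≤+ (s≤s z≤n)
  energy-¬A≤1 true  true  refl = +≤+ (s≤s z≤n)

  energy-¬B≤1 : ∀ A {B} C → B ≡ false → energy A B C ℤ.≤ + 1
  energy-¬B≤1 false _ refl = +≤+ z≤n
  energy-¬B≤1 true  _ refl = +≤+ (s≤s z≤n)

  energy-≤1-monoᴬ : ∀ A A' B C → (A ≡ true → A' ≡ true) →
                    energy A' B C ℤ.≤ + 1 → energy A B C ℤ.≤ + 1
  energy-≤1-monoᴬ false _     B     C     _    _ = energy-¬A≤1 B C refl
  energy-≤1-monoᴬ true  _     false C     _    _ = energy-¬B≤1 true C refl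
  energy-≤1-monoᴬ true  _     true  true  _    _ = +≤+ (s≤s z≤n)
  energy-≤1-monoᴬ true  false true  false A⇒A' _ with A⇒A' refl
  ... | ()
  energy-≤1-monoᴬ true  true  true  false _    (+≤+ (s≤s ()))

  energy-≤1-monoᴮ : ∀ A B B' C → (B ≡ true → B' ≡ true) →
                    energy A B' C ℤ.≤ + 1 → energy A B C ℤ.≤ + 1
  energy-≤1-monoᴮ false B     _     C     _    _ = energy-¬A≤1 B C refl
  energy-≤1-monoᴮ true  false _     C     _    _ = energy-¬B≤1 true C refl
  energy-≤1-monoᴮ true  true  _     true  _    _ = +≤+ (s≤s z≤n)
  energy-≤1-monoᴮ true  true  false false B⇒B' _ with B⇒B' refl
  ... | ()
  energy-≤1-monoᴮ true  true  true  false _    (+≤+ (s≤s ()))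

  Free₀-x‾x : ∀ {x} → x F.< ‾ x → Free₀ (cp x (‾ x))
  Free₀-x‾x x<‾x = (refl , x<‾x⇒toℕ<n x<‾x) , λ ()

  Free₀-‾yy : ∀ {y} → ‾ y F.< y → Free₀ (cp (‾ y) y)
  Free₀-‾yy {y} ‾y<y =
    (sym (‾-involutive y) , x<‾x⇒toℕ<n (subst (‾ y F.<_) (sym (‾-involutive y)) ‾y<y)) , λ ()

  δinf-free : (c : Col n) → Inf c → Free₀ (δinf c)
  δinf-free (cp x y) (x≤y , y<‾x) = Free₀-x‾x (ℕₚ.≤-<-trans x≤y y<‾x)

  δsup-free : (c : Col n) → Sup c → Free₀ (δsup c)
  δsup-free (cp x y) (‾y<x , x≤y) = Free₀-‾yy (ℕₚ.<-≤-trans ‾y<x x≤y)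

  Free₀⇒InS : (c : Col n) → Free₀ c → InS c
  Free₀⇒InS c∅ (_ , c∅≢c∅) = ⊥-elim (c∅≢c∅ refl)
  Free₀⇒InS (cp x y) ((y≡‾x , x<n) , c≢c∅) =
    ℕₚ.<⇒≤ (subst (x F.<_) (sym y≡‾x) (toℕ<n⇒x<‾x x<n)) , c≢c∅

  InS-trichotomy : (c : Col n) → InS c → Free₀ c ⊎ Sup c ⊎ Inf c
  InS-trichotomy c∅ (_ , c∅≢c∅) = ⊥-elim (c∅≢c∅ refl)
  InS-trichotomy (cp x y) (x≤y , _) with y Fₚ.≟ ‾ x
  ... | yes y≡‾x = inj₁ ((y≡‾x , x<‾x⇒toℕ<n (subst (x F.<_) y≡‾x x<y)) , λ ())
    where x<y : x F.< y
          x<y = Fₚ.≤∧≢⇒< x≤y λ x≡y → ‾x≢x x (trans (sym y≡‾x) (sym x≡y))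
  ... | no y≢‾x with toℕ (‾ y) ℕₚ.<? toℕ x
  ...   | yes ‾y<x = inj₂ (inj₁ (‾y<x , x≤y))
  ...   | no ‾y≮x = inj₂ (inj₂ (x≤y , <‾-sym (Fₚ.≤∧≢⇒< (ℕₚ.≮⇒≥ ‾y≮x)
            λ x≡‾y → y≢‾x (trans (sym (‾-involutive y)) (cong ‾_ (sym x≡‾y))))))

  -- Comparing ε with ρ

  Defect : Col n → Col n → Set
  Defect a b = (Free₀ a × b ≡ a) ⊎ (Inf b × a ≡ δinf b) ⊎ (Sup a × b ≡ δsup a)

  ρ≡ε⊎defect : (a b : Col n) → InS a → InS b →
               ρ₀ a b ≡ ε a b ⊎ (ε a b ≡ + 0 × ρ₀ a b ≡ + 1 × Defect a b)
  ρ≡ε⊎defect c∅ _ (_ , a≢c∅) _ = ⊥-elim (a≢c∅ refl)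
  ρ≡ε⊎defect (cp _ _) c∅ _ (_ , b≢c∅) = ⊥-elim (b≢c∅ refl)
  ρ≡ε⊎defect (cp x' y') (cp x y) (x'≤y' , _) (x≤y , _) with ‾ y' Fₚ.≟ x
  ... | no _ = inj₁ refl
  ... | yes refl with x' Fₚ.≟ ‾ y' | Fₚ.<-cmp y y'
  ...   | yes refl | tri< y<y' _ _ =
          inj₂ (energy-cong {C = y' >b x} (>b-false x x ℕₚ.≤-refl) (>b-false y y' (ℕₚ.<⇒≤ y<y')) refl ,
                energy-cong {C = y' >b x} (≥b-true x x ℕₚ.≤-refl) (≥b-false y y' y<y') refl ,
                inj₂ (inj₁ ((x≤y , subst (y F.<_) (sym (‾-involutive y')) y<y') ,
                            cong (cp x) (sym (‾-involutive y')))))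
  ...   | yes refl | tri≈ _ refl _ =
          inj₂ (energy-cong (>b-false x x ℕₚ.≤-refl) (>b-false y y ℕₚ.≤-refl) C ,
                energy-cong (≥b-true x x ℕₚ.≤-refl) (≥b-true y y ℕₚ.≤-refl) C ,
                inj₁ (Free₀-‾yy ‾y<y , refl))
    where ‾y<y : ‾ y F.< y
          ‾y<y = Fₚ.≤∧≢⇒< x≤y (‾x≢x y)
          C : y >b x ≡ true
          C = >b-true y x ‾y<y
  ...   | yes refl | tri> _ _ y'<y =
          inj₁ (trans (energy-cong (≥b-true x x ℕₚ.≤-refl) (≥b-true y y' (ℕₚ.<⇒≤ y'<y)) C)
                      (sym (energy-cong (>b-false x x ℕₚ.≤-refl) (>b-true y y' y'<y) C)))
    where C : y' >b x ≡ true
          C = >b-true y' x (Fₚ.≤∧≢⇒< x'≤y' (‾x≢x y'))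
  ...   | no x'≢x | tri< _ y≢y' _ =
          inj₁ (energy-cong (≥b≡>b x x' (x'≢x ∘ sym)) (≥b≡>b y y' y≢y') refl)
  ...   | no x'≢x | tri> _ y≢y' _ =
          inj₁ (energy-cong (≥b≡>b x x' (x'≢x ∘ sym)) (≥b≡>b y y' y≢y') refl)
  ...   | no x'≢x | tri≈ _ refl _ with Fₚ.<-cmp x' x
  ...     | tri< x'<x _ _ =
            inj₁ (trans (energy-cong (≥b-true x x' (ℕₚ.<⇒≤ x'<x)) (≥b-true y y ℕₚ.≤-refl) C)
                        (sym (energy-cong (>b-true x x' x'<x) (>b-false y y ℕₚ.≤-refl) C)))
    where C : y >b x ≡ true
          C = >b-true y x (Fₚ.≤∧≢⇒< x≤y (‾x≢x y))
  ...     | tri≈ _ x'≡x _ = ⊥-elim (x'≢x x'≡x)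
  ...     | tri> _ _ x<x' =
            inj₂ (energy-cong (>b-false x x' (ℕₚ.<⇒≤ x<x')) (>b-false y y ℕₚ.≤-refl) C ,
                  energy-cong (≥b-false x x' x<x') (≥b-true y y ℕₚ.≤-refl) C ,
                  inj₂ (inj₂ ((x<x' , x'≤y') , refl)))
    where C : y >b x ≡ true
          C = >b-true y x (ℕₚ.<-≤-trans x<x' x'≤y')

  ε-nonneg : (a b : Col n) → + 0 ℤ.≤ ε a b
  ε-nonneg c∅       c∅       = +≤+ z≤n
  ε-nonneg c∅       (cp _ _) = +≤+ z≤n
  ε-nonneg (cp _ _) c∅       = +≤+ z≤n
  ε-nonneg (cp x' y') (cp x y) with ‾ y' Fₚ.≟ x
  ... | yes _ = energy-nonneg (x >b x') (y >b y') (y' >b x)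
  ... | no _  = energy-nonneg (x ≥b x') (y ≥b y') (y' >b x)

  ε≤ρ : (a b : Col n) → InS a → InS b → ε a b ℤ.≤ ρ₀ a b
  ε≤ρ a b a∈ b∈ with ρ≡ε⊎defect a b a∈ b∈
  ... | inj₁ ρ≡ε = ℤₚ.≤-reflexive (sym ρ≡ε)
  ... | inj₂ (ε≡0 , ρ≡1 , _) = subst₂ ℤ._≤_ (sym ε≡0) (sym ρ≡1) (+≤+ z≤n)

  E-nonneg : (E : Col n → ℤ) → Admissible E → (c : Col n) → InS c → + 0 ℤ.≤ E c
  E-nonneg E (free , inf , sup) c c∈ with InS-trichotomy c c∈
  ... | inj₁ (f , _)  = nonneg-≡ (free c f)
  ... | inj₂ (inj₁ s) = [ nonneg-≡ , nonneg-≡ ]′ (sup c s)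
  ... | inj₂ (inj₂ i) = [ nonneg-≡ , nonneg-≡ ]′ (inf c i)

  -- Cls5b d says d ∈ 𝒮 ⊔ {c_∞}.
  εX-nonneg : (E : Col n → ℤ) → Admissible E → {c : Col n} (d : XCol n) →
              InS c → Cls5b d → + 0 ℤ.≤ εX E c d
  εX-nonneg E adm {c} (col d) _  _ = ε-nonneg c d
  εX-nonneg E adm {c} c∞      c∈ _ = E-nonneg E adm c c∈

  εX≤ρ : (E : Col n → ℤ) {c : Col n} (d : XCol n) → InS c → Cls5b d → εX E c d ℤ.≤ ρ E c d
  εX≤ρ E {c} (col d) c∈ d∈ = ε≤ρ c d c∈ d∈
  εX≤ρ E     c∞      _  _  = ℤₚ.≤-refl

  ε-δinfʳ≤1⇒ε≤1 : (c b : Col n) → Inf b → ε c (δinf b) ℤ.≤ + 1 → ε c b ℤ.≤ + 1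
  ε-δinfʳ≤1⇒ε≤1 c∅         (cp _ _) _          _ = ℤₚ.≤-refl
  ε-δinfʳ≤1⇒ε≤1 (cp x' y') (cp x y) (_ , y<‾x) h with ‾ y' Fₚ.≟ x
  ... | yes refl =
        energy-¬B≤1 (‾ y' >b x') (y' >b ‾ y')
          (>b-false y y' (ℕₚ.<⇒≤ (subst (y F.<_) (‾-involutive y') y<‾x)))
  ... | no _ =
        energy-≤1-monoᴮ (x ≥b x') (y ≥b y') (‾ x ≥b y') (y' >b x)
          (λ y≥y' → ≥b-true (‾ x) y' (ℕₚ.<⇒≤ (ℕₚ.≤-<-trans (≥b-true⁻¹ y y' y≥y') y<‾x))) h

  ε-δsupˡ≤1⇒ε≤1 : (a e : Col n) → Sup a → ε (δsup a) e ℤ.≤ + 1 → ε a e ℤ.≤ + 1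
  ε-δsupˡ≤1⇒ε≤1 (cp _ _) c∅           _          _ = ℤₚ.≤-refl
  ε-δsupˡ≤1⇒ε≤1 (cp x y) (cp x'' y'') (‾y<x , _) h with ‾ y Fₚ.≟ x''
  ... | yes refl = energy-¬A≤1 (y'' >b y) (y >b ‾ y) (>b-false (‾ y) x (ℕₚ.<⇒≤ ‾y<x))
  ... | no _ =
        energy-≤1-monoᴬ (x'' ≥b x) (x'' ≥b ‾ y) (y'' ≥b y) (y >b x'')
          (λ x''≥x → ≥b-true x'' (‾ y) (ℕₚ.<⇒≤ (ℕₚ.<-≤-trans ‾y<x (≥b-true⁻¹ x'' x x''≥x)))) h

  ε-δinfʳ≤0-cases : (c b : Col n) → InS c → Inf b → ε c (δinf b) ℤ.≤ + 0 →
                    c ≡ δinf b ⊎ (Sup c × ε c b ≡ + 0 × γsi c b ≡ δinf b)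
  ε-δinfʳ≤0-cases c∅ _ (_ , c≢c∅) _ _ = ⊥-elim (c≢c∅ refl)
  ε-δinfʳ≤0-cases (cp x' y') (cp x y) (x'≤y' , _) (_ , y<‾x) h with ‾ y' Fₚ.≟ x
  ... | no _ =
        inj₂ ((ℕₚ.<-trans ‾y'<x x<x' , x'≤y') ,
              energy-cong (≥b-false x x' x<x') (≥b-false y y' (ℕₚ.<-trans y<‾x ‾x<y')) refl ,
              cong (λ z → cp z (‾ z)) (maxL-> ‾y'<x))
    where ¬A¬B : x ≥b x' ≡ false × ‾ x ≥b y' ≡ false
          ¬A¬B = energy≤0⇒ (x ≥b x') (‾ x ≥b y') (y' >b x) h
          x<x' : x F.< x'
          x<x' = ≥b-false⁻¹ x x' (proj₁ ¬A¬B)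
          ‾x<y' : ‾ x F.< y'
          ‾x<y' = ≥b-false⁻¹ (‾ x) y' (proj₂ ¬A¬B)
          ‾y'<x : ‾ y' F.< x
          ‾y'<x = ‾<-sym ‾x<y'
  ... | yes refl with x Fₚ.≟ x'
  ...   | yes refl = inj₁ (cong (cp x') (sym (‾-involutive y')))
  ...   | no x≢x' =
          inj₂ ((Fₚ.≤∧≢⇒< x≤x' x≢x' , x'≤y') ,
                energy-cong (>b-false x x' x≤x') (>b-false y y' (ℕₚ.<⇒≤ y<y')) refl ,
                cong (λ z → cp z (‾ z)) (maxL-idem x))
    where x≤x' : x F.≤ x'
          x≤x' = >b-false⁻¹ x x' (proj₁ (energy≤0⇒ (x >b x') (‾ x >b y') (y' >b x) h))
          y<y' : y F.< y'
          y<y' = subst (y F.<_) (‾-involutive y') y<‾x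

  cp-z‾z≡cp-‾yy : ∀ y {z} → z ≡ ‾ y → cp {n} z (‾ z) ≡ cp (‾ y) y
  cp-z‾z≡cp-‾yy y refl = cong (cp (‾ y)) (‾-involutive y)

  ε-δsupˡ≤0-cases : (a e : Col n) → Sup a → InS e → ε (δsup a) e ℤ.≤ + 0 →
                    e ≡ δsup a ⊎ (Inf e × ε a e ≡ + 0 × γsi a e ≡ δsup a)
  ε-δsupˡ≤0-cases (cp x y) c∅ _ (_ , e≢c∅) _ = ⊥-elim (e≢c∅ refl)
  ε-δsupˡ≤0-cases (cp x y) (cp xe ye) (‾y<x , _) (xe≤ye , _) h with ‾ y Fₚ.≟ xe
  ... | no _ =
        inj₂ ((xe≤ye , ℕₚ.<-trans ye<y (<‾-sym xe<‾y)) ,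
              energy-cong (≥b-false xe x (ℕₚ.<-trans xe<‾y ‾y<x)) (≥b-false ye y ye<y) refl ,
              cp-z‾z≡cp-‾yy y (maxL-≤ (ℕₚ.<⇒≤ xe<‾y)))
    where ¬A¬B : xe ≥b ‾ y ≡ false × ye ≥b y ≡ false
          ¬A¬B = energy≤0⇒ (xe ≥b ‾ y) (ye ≥b y) (y >b xe) h
          xe<‾y : xe F.< ‾ y
          xe<‾y = ≥b-false⁻¹ xe (‾ y) (proj₁ ¬A¬B)
          ye<y : ye F.< y
          ye<y = ≥b-false⁻¹ ye y (proj₂ ¬A¬B)
  ... | yes refl with ye Fₚ.≟ y
  ...   | yes refl = inj₁ refl
  ...   | no ye≢y =
          inj₂ ((xe≤ye , subst (ye F.<_) (sym (‾-involutive y)) (Fₚ.≤∧≢⇒< ye≤y ye≢y)) ,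
                energy-cong (>b-false (‾ y) x (ℕₚ.<⇒≤ ‾y<x)) (>b-false ye y ye≤y) refl ,
                cp-z‾z≡cp-‾yy y (maxL-idem (‾ y)))
    where ye≤y : ye F.≤ y
          ye≤y = >b-false⁻¹ ye y (proj₂ (energy≤0⇒ (‾ y >b ‾ y) (ye >b y) (y >b ‾ y) h))

  ρ-δsup≥1 : (c : Col n) → Sup c → + 1 ℤ.≤ ρ₀ c (δsup c)
  ρ-δsup≥1 (cp x y) _ = energy-B≥1 (‾ y ≥b x) (y >b ‾ y) (≥b-true y y ℕₚ.≤-refl)

  ρ-δinf≥1 : (c : Col n) → Inf c → + 1 ℤ.≤ ρ₀ (δinf c) c
  ρ-δinf≥1 (cp x y) _ = energy-A≥1 (y ≥b ‾ x) (‾ x >b x) (≥b-true x x ℕₚ.≤-refl)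

  ρ-free≥1 : (c : Col n) → Free₀ c → + 1 ℤ.≤ ρ₀ c c
  ρ-free≥1 c∅ (_ , c∅≢c∅) = ⊥-elim (c∅≢c∅ refl)
  ρ-free≥1 (cp x y) _ = energy-A≥1 (y ≥b y) (y >b x) (≥b-true x x ℕₚ.≤-refl)

  ρ-γsi≥1 : (c c' : Col n) → Sup c → Inf c' →
            + 1 ℤ.≤ ρ₀ c (γsi c c') ⊎ + 1 ℤ.≤ ρ₀ (γsi c c') c'
  ρ-γsi≥1 (cp x y) (cp x' y') _ _ with toℕ (‾ y) ℕₚ.<? toℕ x'
  ... | no ‾y≮x' =
        inj₁ (subst (λ z → + 1 ℤ.≤ ρ₀ (cp x y) (cp {n} z (‾ z))) (sym (maxL-≤ (ℕₚ.≮⇒≥ ‾y≮x')))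
               (energy-B≥1 (‾ y ≥b x) (y >b ‾ y)
                 (≥b-true (‾ (‾ y)) y (ℕₚ.≤-reflexive (cong toℕ (sym (‾-involutive y)))))))
  ... | yes ‾y<x' =
        inj₂ (subst (λ z → + 1 ℤ.≤ ρ₀ (cp {n} z (‾ z)) (cp x' y')) (sym (maxL-> ‾y<x'))
               (energy-A≥1 (y' ≥b ‾ x') (‾ x' >b x') (≥b-true x' x' ℕₚ.≤-refl)))

  pattern₂ : ∀ {q} {c c' m : Col n} → Sup c → Inf c' → ε c c' ≡ + 0 → γsi c c' ≡ m →
             Bad3 (+ q , col c) (+ q , col m) (+ q , col c')
  pattern₂ {q} {c} {c'} s i ε≡0 refl = q , inj₁ (c , c' , s , i , ε≡0 , refl , refl , refl)

  ε≡0⊎1 : ∀ c c' → ε c c' ℤ.≤ + 1 → ε c c' ≡ + 0 ⊎ ε c c' ≡ + 1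
  ε≡0⊎1 c c' ε≤1 with ε c c' | ε-nonneg c c'
  ... | + zero          | _ = inj₁ refl
  ... | + suc zero      | _ = inj₂ refl
  ... | + suc (suc _)   | _ with ε≤1
  ...   | +≤+ (s≤s ())

  pattern₃ : ∀ {q} {c c' : Col n} → Sup c → Sup c' → ε c c' ℤ.≤ + 1 →
             Bad3 (+ suc q , col c) (+ suc q , col (δsup c)) (+ q , col c')
  pattern₃ {q} {cp x y} {c'} s s' ε≤1 =
    suc q , inj₂ (inj₁ (cp x y , c' , s , s' , ε≡0⊎1 (cp x y) c' ε≤1 , refl , refl , refl))

  pattern₄ : ∀ {q} {c c' : Col n} → Inf c → Inf c' → ε c c' ℤ.≤ + 1 →
             Bad3 (+ suc q , col c) (+ q , col (δinf c')) (+ q , col c')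
  pattern₄ {q} {c} {cp x y} i i' ε≤1 =
    q , inj₂ (inj₂ (inj₁ (c , cp x y , i , i' , ε≡0⊎1 c (cp x y) ε≤1 , refl , refl , refl)))

  pattern₅ₐ : ∀ {q} {c : Col n} {d : XCol n} → Sup c → Cls5a d →
              Bad3 (+ suc q , col c) (+ suc q , col (δsup c)) (+ q , d)
  pattern₅ₐ {q} {c} {d} s d∈ =
    suc q , inj₂ (inj₂ (inj₂ (inj₁ (c , d , s , d∈ , refl , refl , refl))))

  pattern₅ᵦ : ∀ {q u} {c : Col n} {d : XCol n} → Sup c → Cls5b d → 2 ℕ.≤ u →
              Bad3 (+ (q ℕ.+ u) , col c) (+ (q ℕ.+ u) , col (δsup c)) (+ q , d)
  pattern₅ᵦ {q} {u} {c} {d} s d∈ 2≤u =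
    q ℕ.+ u , inj₂ (inj₂ (inj₂ (inj₂ (inj₁
      (c , d , u , s , d∈ , 2≤u , refl , refl , cong (_, d) (sym (+[m+n]-+n≡+m q u)))))))

  pattern₆ᵦ : ∀ {q} {c c' : Col n} → Inf c' → Free₀ c ⊎ Sup c →
              Bad3 (+ suc q , col c) (+ q , col (δinf c')) (+ q , col c')
  pattern₆ᵦ {q} {c} {c'} i c∈ =
    q , inj₂ (inj₂ (inj₂ (inj₂ (inj₂ (inj₁ (c , c' , i , c∈ , refl , refl , refl))))))

  pattern₆ᶜ : ∀ {q u} {c c' : Col n} → Inf c' → InS c → 2 ℕ.≤ u →
              Bad3 (+ (q ℕ.+ u) , col c) (+ q , col (δinf c')) (+ q , col c')
  pattern₆ᶜ {q} {u} {c} {c'} i c∈ 2≤u =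
    q , inj₂ (inj₂ (inj₂ (inj₂ (inj₂ (inj₂ (c , c' , u , i , c∈ , 2≤u , refl , refl , refl))))))

  flat-δinf-step-forbidden :
    ∀ {k k'} (a c' : Col n) → InS a → Inf c' → Gap (ε a (δinf c')) k k' →
    ¬ Bad2 (k , col a) (k' , col (δinf c')) →
    ¬ Bad3 (k , col a) (k' , col (δinf c')) (k' , col c') → ⊥
  flat-δinf-step-forbidden a c' a∈ i (flat q ε≤0) ¬bad2 ¬bad3
    with ε-δinfʳ≤0-cases a c' a∈ i ε≤0
  ... | inj₁ refl = ¬bad2 (q , δinf c' , δinf-free c' i , refl , refl)
  ... | inj₂ (s , ε≡0 , γ≡δ) = ¬bad3 (pattern₂ s i ε≡0 γ≡δ)
  flat-δinf-step-forbidden a c' a∈ i (unit q ε≤1) _ ¬bad3 with InS-trichotomy a a∈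
  ... | inj₁ f = ¬bad3 (pattern₆ᵦ i (inj₁ f))
  ... | inj₂ (inj₁ s) = ¬bad3 (pattern₆ᵦ i (inj₂ s))
  ... | inj₂ (inj₂ i') = ¬bad3 (pattern₄ i' i (ε-δinfʳ≤1⇒ε≤1 a c' i ε≤1))
  flat-δinf-step-forbidden a c' a∈ i (large q u 2≤u) _ ¬bad3 = ¬bad3 (pattern₆ᶜ i a∈ 2≤u)

  flat-δsup-step-forbidden :
    (E : Col n → ℤ) → Admissible E → ∀ {k k'} (c : Col n) (d : XCol n) →
    Sup c → Cls5b d → Gap (εX E (δsup c) d) k k' →
    ¬ Bad2 (k , col (δsup c)) (k' , d) →
    ¬ Bad3 (k , col c) (k , col (δsup c)) (k' , d) → ⊥
  flat-δsup-step-forbidden E (free , _) c c∞ s _ (flat q E≤0) _ _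
    with ℤₚ.≤-trans (ℤₚ.≤-reflexive (sym (free (δsup c) (proj₁ (δsup-free c s))))) E≤0
  ... | +≤+ ()
  flat-δsup-step-forbidden E _ c (col e) s e∈ (flat q ε≤0) ¬bad2 ¬bad3
    with ε-δsupˡ≤0-cases c e s e∈ ε≤0
  ... | inj₁ refl = ¬bad2 (q , δsup c , δsup-free c s , refl , refl)
  ... | inj₂ (i , ε≡0 , γ≡δ) = ¬bad3 (pattern₂ s i ε≡0 γ≡δ)
  flat-δsup-step-forbidden E _ c c∞ s _ (unit q _) _ ¬bad3 = ¬bad3 (pattern₅ₐ s tt)
  flat-δsup-step-forbidden E _ c (col e) s e∈ (unit q ε≤1) _ ¬bad3 with InS-trichotomy e e∈
  ... | inj₁ f = ¬bad3 (pattern₅ₐ s (inj₁ f))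
  ... | inj₂ (inj₁ s') = ¬bad3 (pattern₃ s s' (ε-δsupˡ≤1⇒ε≤1 c e s ε≤1))
  ... | inj₂ (inj₂ i) = ¬bad3 (pattern₅ₐ s (inj₂ i))
  flat-δsup-step-forbidden E _ c d s d∈ (large q u 2≤u) _ ¬bad3 = ¬bad3 (pattern₅ᵦ s d∈ 2≤u)

  InS′ : Part n → Set
  InS′ π = InS (proj₂ π)

  NonNeg : {A : Set} → ℤ × A → Set
  NonNeg π = + 0 ℤ.≤ proj₁ π

  Rρ : (Col n → ℤ) → Part n → XPart n → Set
  Rρ E π π′ = ρ E (proj₂ π) (proj₂ π′) ℤ.≤ proj₁ π ℤ.- proj₁ π′

  lead : List (Part n) → XPart n
  lead []      = + 0 , c∞
  lead (q ∷ _) = inj q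

  Chain-lead : ∀ {R : Part n → XPart n → Set} b qs → Chain R (b ∷ qs) → R b (lead qs)
  Chain-lead b []      r       = r
  Chain-lead b (_ ∷ _) (r , _) = r

  lead-InS : ∀ qs → All InS′ qs → Cls5b (proj₂ (lead qs))
  lead-InS []      _       = tt
  lead-InS (_ ∷ _) (q∈ ∷ _) = q∈

  lead-nonneg : ∀ qs → All NonNeg qs → NonNeg (lead qs)
  lead-nonneg []      _        = +≤+ z≤n
  lead-nonneg (_ ∷ _) (0≤q ∷ _) = 0≤q

  Occ2-lead : ∀ {P} a qs → ¬ Occ2 P (full (a ∷ qs)) → ¬ P (inj a) (lead qs)
  Occ2-lead a []      ¬occ p = ¬occ (inj₁ p)
  Occ2-lead a (_ ∷ _) ¬occ p = ¬occ (inj₁ p)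

  Occ3-uncons : ∀ {P} a b qs → ¬ Occ3 P (full (a ∷ b ∷ qs)) →
                ¬ P (inj a) (inj b) (lead qs) × ¬ Occ3 P (full (b ∷ qs))
  Occ3-uncons a b []      ¬occ = (¬occ ∘ inj₁) , λ ()
  Occ3-uncons a b (_ ∷ _) ¬occ = (¬occ ∘ inj₁) , (¬occ ∘ inj₂)

  First2-lead : ∀ {P} a qs → ¬ First2 P (full (a ∷ qs)) → ¬ P (inj a) (lead qs)
  First2-lead a []      ¬first = ¬first
  First2-lead a (_ ∷ _) ¬first = ¬first

  Chain-map : ∀ {R R′ : Part n → XPart n → Set} →
              (∀ {π π′} → InS′ π → Cls5b (proj₂ π′) → R π π′ → R′ π π′) →
              ∀ {ps} → All InS′ ps → Chain R ps → Chain R′ ps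
  Chain-map f {[]}        _               _        = tt
  Chain-map f {_ ∷ []}    (π∈ ∷ _)        r        = f π∈ tt r
  Chain-map f {_ ∷ _ ∷ _} (π∈ ∷ π′∈ ∷ ∈s) (r , rs) = f π∈ π′∈ r , Chain-map f (π′∈ ∷ ∈s) rs

  heights-nonneg : (E : Col n → ℤ) → Admissible E → (ps : List (Part n)) →
                   All InS′ ps → Chain (Gg E) ps → All NonNeg ps
  heights-nonneg E adm [] _ _ = []
  heights-nonneg E adm ((_ , c) ∷ []) (c∈ ∷ []) g =
    nonneg-above {k' = + 0} (E-nonneg E adm c c∈) g (+≤+ z≤n) ∷ []
  heights-nonneg E adm ((_ , c) ∷ (_ , c') ∷ qs) (_ ∷ c'∈ ∷ ∈s) (g , gs)
    with heights-nonneg E adm (_ ∷ qs) (c'∈ ∷ ∈s) gs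
  ... | 0≤k' ∷ 0≤s = nonneg-above (ε-nonneg c c') g 0≤k' ∷ 0≤k' ∷ 0≤s

  -- ρ-sequences avoid the forbidden patterns

  Rρ-avoids-Bad3 : (E : Col n → ℤ) (a b : Part n) (d : XPart n) →
                   Rρ E a (inj b) → Rρ E b d → ¬ Bad3 (inj a) (inj b) d
  Rρ-avoids-Bad3 E _ _ _ r r′ (p , inj₁ (c , c' , s , i , _ , refl , refl , refl))
    with ρ-γsi≥1 c c' s i
  ... | inj₁ 1≤ρ = ≥1⇒≰i-i (+ p) 1≤ρ r
  ... | inj₂ 1≤ρ = ≥1⇒≰i-i (+ p) 1≤ρ r′
  Rρ-avoids-Bad3 E _ _ _ r _ (p , inj₂ (inj₁ (cp x y , _ , s , _ , _ , refl , refl , refl))) =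
    ≥1⇒≰i-i (+ p) (ρ-δsup≥1 (cp x y) s) r
  Rρ-avoids-Bad3 E _ _ _ _ r′ (p , inj₂ (inj₂ (inj₁ (_ , cp x y , _ , i , _ , refl , refl , refl)))) =
    ≥1⇒≰i-i (+ p) (ρ-δinf≥1 (cp x y) i) r′
  Rρ-avoids-Bad3 E _ _ _ r _ (p , inj₂ (inj₂ (inj₂ (inj₁ (c , _ , s , _ , refl , refl , refl))))) =
    ≥1⇒≰i-i (+ p) (ρ-δsup≥1 c s) r
  Rρ-avoids-Bad3 E _ _ _ r _ (p , inj₂ (inj₂ (inj₂ (inj₂ (inj₁ (c , _ , _ , s , _ , _ , refl , refl , refl)))))) =
    ≥1⇒≰i-i (+ p) (ρ-δsup≥1 c s) r
  Rρ-avoids-Bad3 E _ _ _ _ r′ (p , inj₂ (inj₂ (inj₂ (inj₂ (inj₂ (inj₁ (_ , c' , i , _ , refl , refl , refl))))))) =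
    ≥1⇒≰i-i (+ p) (ρ-δinf≥1 c' i) r′
  Rρ-avoids-Bad3 E _ _ _ _ r′ (p , inj₂ (inj₂ (inj₂ (inj₂ (inj₂ (inj₂ (_ , c' , _ , i , _ , _ , refl , refl , refl))))))) =
    ≥1⇒≰i-i (+ p) (ρ-δinf≥1 c' i) r′

  Rρ-avoids-Occ2 : (E : Col n → ℤ) (ps : List (Part n)) → Chain (Rρ E) ps → ¬ Occ2 Bad2 (full ps)
  Rρ-avoids-Occ2 E (_ ∷ []) _ (inj₁ (_ , _ , _ , _ , ()))
  Rρ-avoids-Occ2 E (_ ∷ _ ∷ _) (r , _) (inj₁ (p , c , f , refl , refl)) =
    ≥1⇒≰i-i (+ p) (ρ-free≥1 c f) r
  Rρ-avoids-Occ2 E (_ ∷ ps@(_ ∷ _)) (_ , rs) (inj₂ occ) = Rρ-avoids-Occ2 E ps rs occ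

  Rρ-avoids-Occ3 : (E : Col n → ℤ) (ps : List (Part n)) → Chain (Rρ E) ps → ¬ Occ3 Bad3 (full ps)
  Rρ-avoids-Occ3 E (a ∷ b ∷ []) (r , r′) (inj₁ bad) = Rρ-avoids-Bad3 E a b _ r r′ bad
  Rρ-avoids-Occ3 E (a ∷ b ∷ _ ∷ _) (r , r′ , _) (inj₁ bad) = Rρ-avoids-Bad3 E a b _ r r′ bad
  Rρ-avoids-Occ3 E (_ ∷ ps@(_ ∷ _ ∷ _)) (_ , rs) (inj₂ occ) = Rρ-avoids-Occ3 E ps rs occ

  Rρ-avoids-BadStart : (E : Col n → ℤ) (ps : List (Part n)) → Chain (Rρ E) ps →
                       ¬ First2 BadStart (full ps)
  Rρ-avoids-BadStart E (_ ∷ []) _ (_ , _ , _ , _ , ())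
  Rρ-avoids-BadStart E (_ ∷ _ ∷ _) (r , _) (p , c' , i , refl , refl) =
    ≥1⇒≰i-i (+ p) (ρ-δinf≥1 c' i) r

  ρ⇒δγ : (E : Col n → ℤ) (ps : List (Part n)) → InPρ E ps → InPδγ E ps
  ρ⇒δγ E ps (∈S , ch) =
    (proj₁ (unzip ∈S) , Chain-map (λ {π} {π′} π∈ π′∈ r → ℤₚ.≤-trans (εX≤ρ E (proj₂ π′) π∈ π′∈) r) ∈S ch) ,
    proj₂ (unzip ∈S) ,
    Rρ-avoids-Occ2 E ps ch , Rρ-avoids-Occ3 E ps ch , Rρ-avoids-BadStart E ps ch

  -- Pattern-avoiding ε-sequences are ρ-sequences

  ¬BadStart-after : ∀ {k k'} (a b : Col n) (d : XPart n) → InS a → ε a b ℤ.≤ k ℤ.- k' →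
                    ¬ Bad2 (k , col a) (k' , col b) → ¬ Bad3 (k , col a) (k' , col b) d →
                    ¬ BadStart (k' , col b) d
  ¬BadStart-after a _ _ a∈ g ¬bad2 ¬bad3 (_ , c' , i , refl , refl) =
    flat-δinf-step-forbidden a c' a∈ i (gap (+≤+ z≤n) (ε-nonneg a (δinf c')) g) ¬bad2 ¬bad3

  ρ-step : (E : Col n → ℤ) → Admissible E → (p q : ℕ) (a b : Col n) (d : XPart n) →
           InS a → InS b → Cls5b (proj₂ d) → NonNeg d →
           ε a b ℤ.≤ + p ℤ.- + q → Gg E (+ q , b) d →
           ¬ Bad2 (+ p , col a) (+ q , col b) → ¬ Bad2 (+ q , col b) d →
           ¬ Bad3 (+ p , col a) (+ q , col b) d → ¬ BadStart (+ p , col a) (+ q , col b) →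
           ρ₀ a b ℤ.≤ + p ℤ.- + q
  ρ-step E adm p q a b (_ , d) a∈ b∈ d∈ 0≤d g g′ ¬bad2 ¬bad2′ ¬bad3 ¬start
    with ρ≡ε⊎defect a b a∈ b∈
  ... | inj₁ ρ≡ε = subst (ℤ._≤ _) (sym ρ≡ε) g
  ... | inj₂ (ε≡0 , ρ≡1 , defect) with p ℕₚ.≟ q
  ...   | no p≢q =
          subst (ℤ._≤ _) (sym ρ≡1) (1≤i-j (subst (ℤ._≤ _) ε≡0 g) (p≢q ∘ ℤₚ.+-injective))
  ...   | yes refl with defect
  ...     | inj₁ (f , refl) = ⊥-elim (¬bad2 (p , a , f , refl , refl))
  ...     | inj₂ (inj₁ (i , refl)) = ⊥-elim (¬start (p , b , i , refl , refl))
  ...     | inj₂ (inj₂ (s , refl)) =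
              ⊥-elim (flat-δsup-step-forbidden E adm a d s d∈
                        (gap 0≤d (εX-nonneg E adm d (Free₀⇒InS (δsup a) (δsup-free a s)) d∈) g′)
                        ¬bad2′ ¬bad3)

  ρ-chain : (E : Col n → ℤ) → Admissible E → (a : Part n) (qs : List (Part n)) →
            All InS′ (a ∷ qs) → All NonNeg (a ∷ qs) → Chain (Gg E) (a ∷ qs) →
            ¬ Occ2 Bad2 (full (a ∷ qs)) → ¬ Occ3 Bad3 (full (a ∷ qs)) →
            ¬ BadStart (inj a) (lead qs) → Chain (Rρ E) (a ∷ qs)
  ρ-chain E adm a [] _ _ g _ _ _ = g
  ρ-chain E adm (_ , a) ((_ , b) ∷ qs) (a∈ ∷ b∈ ∷ ∈s) (+≤+ {n = p} _ ∷ +≤+ {n = q} _ ∷ 0≤s)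
          (g , gs) ¬occ2 ¬occ3 ¬start =
    ρ-step E adm p q a b (lead qs) a∈ b∈ (lead-InS qs ∈s) (lead-nonneg qs 0≤s) g
           (Chain-lead _ qs gs) (¬occ2 ∘ inj₁) (Occ2-lead _ qs (¬occ2 ∘ inj₂)) ¬bad3 ¬start ,
    ρ-chain E adm (+ q , b) qs (b∈ ∷ ∈s) (+≤+ z≤n ∷ 0≤s) gs (¬occ2 ∘ inj₂) ¬occ3′
            (¬BadStart-after a b (lead qs) a∈ g (¬occ2 ∘ inj₁) ¬bad3)
    where
    ¬bad3 : ¬ Bad3 (+ p , col a) (+ q , col b) (lead qs)
    ¬bad3 = proj₁ (Occ3-uncons (+ p , a) (+ q , b) qs ¬occ3)
    ¬occ3′ : ¬ Occ3 Bad3 (full ((+ q , b) ∷ qs))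
    ¬occ3′ = proj₂ (Occ3-uncons (+ p , a) (+ q , b) qs ¬occ3)

  δγ⇒ρ : (E : Col n → ℤ) → Admissible E → (ps : List (Part n)) → InPδγ E ps → InPρ E ps
  δγ⇒ρ E adm [] _ = [] , tt
  δγ⇒ρ E adm (a ∷ qs) ((∈C , ch) , ≢c∅ , ¬occ2 , ¬occ3 , ¬first) =
    ∈S , ρ-chain E adm a qs ∈S (heights-nonneg E adm (a ∷ qs) ∈S ch) ch ¬occ2 ¬occ3
                 (First2-lead a qs ¬first)
    where ∈S : All InS′ (a ∷ qs)
          ∈S = zip (∈C , ≢c∅)

lemma3p11 : (n : ℕ) (E : Col n → ℤ) → Admissible E →
    (ps : List (Part n)) → InPδγ E ps ⇔ InPρ E ps
lemma3p11 n E adm ps = mk⇔ (δγ⇒ρ E adm ps) (ρ⇒δγ E ps)
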